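{- Let $m>0$ and let $(X,R)$ be a frame with $R^{m+1}\subseteq R\cup Id_X$. For $a,b\in X$: if $aR^{mn+1}b$ for some $n\ge 0$ and $a,b$ lie in different clusters, then $aRb$.
   Context: $R^0=Id_X$, $R^{i+1}=R\circ R^i$, $R^*=\bigcup_{i<\omega}R^i$. A cluster is an equivalence class of the relation $a\sim b$ iff $aR^*b$ and $bR^*a$. -}

module Defs where

open import Level using (Level; _⊔_)
open import Data.Nat using (ℕ; zero; suc)
open import Data.Product using (Σ; _×_; ∃-syntax)
open import Data.Sum using (_⊎_)
open import Relation.Binary.PropositionalEquality using (_≡_)

record Frame (a r : Level) : Set (Level.suc (a ⊔ r)) where
  field
    X : Set a
    R : X → X → Set r

module _ {a r : Level} {X : Set a} (R : X → X → Set r) where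

  Pow : ℕ → X → X → Set (a ⊔ r)
  Pow zero    x y = Level.Lift (a ⊔ r) (x ≡ y)
  Pow (suc i) x y = ∃[ z ] (R x z × Pow i z y)

  Star : X → X → Set (a ⊔ r)
  Star x y = ∃[ i ] Pow i x y

  SameCluster : X → X → Set (a ⊔ r)
  SameCluster x y = Star x y × Star y x

{-# OPTIONS --safe #-}
module Submission where

-- Take the first window x R v R^m w of a path x R^{m+1+t} y. The hypothesis
-- gives either x R w, which cuts m steps, or w = x; then v R^m x closes a loop
-- back to x and the window slides one step forward. Sliding until the window
-- ends in y either finds a cut or shows y R* x. Iterating the cut reduces
-- x R^{mn+1} y to x R y unless y R* x, which together with x R* y would put
-- x and y in one cluster.

open import Defs
open import Level using (Level; lift)
open import Data.Nat using (ℕ; _+_; _*_; _>_; zero; suc)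
open import Data.Nat.Properties using (+-comm; *-suc; *-zeroʳ)
open import Data.Sum using (_⊎_; inj₁; inj₂; map; [_,_])
open import Data.Product using (_,_; ∃-syntax; _×_)
open import Relation.Binary.PropositionalEquality using (_≡_; refl; subst)
open import Relation.Nullary using (¬_)
open import Data.Empty using (⊥-elim)
open import Function using (id)

module _ {a r : Level} {X : Set a} (R : X → X → Set r) where

  Pow-++ : ∀ i j {x y z} → Pow R i x y → Pow R j y z → Pow R (i + j) x z
  Pow-++ zero    j (lift refl)   q = q
  Pow-++ (suc i) j (w , xRw , p) q = w , xRw , Pow-++ i j p q

  Pow-snoc : ∀ i {x y z} → Pow R i x y → R y z → Pow R (suc i) x z
  Pow-snoc zero    (lift refl)   yRz = _ , yRz , lift refl
  Pow-snoc (suc i) (w , xRw , p) yRz = w , xRw , Pow-snoc i p yRz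

  Pow-split : ∀ i j {x z} → Pow R (i + j) x z → ∃[ y ] (Pow R i x y × Pow R j y z)
  Pow-split zero    j {x} p = x , lift refl , p
  Pow-split (suc i) j (w , xRw , p) with Pow-split i j p
  ... | y , p₁ , p₂ = y , (w , xRw , p₁) , p₂

  Pow-1⇒R : ∀ {x y} → Pow R 1 x y → R x y
  Pow-1⇒R (_ , xRy , lift refl) = xRy

  Star-trans : ∀ {x y z} → Star R x y → Star R y z → Star R x z
  Star-trans (i , p) (j , q) = i + j , Pow-++ i j p q

  module _ (m : ℕ) (R¹⁺ᵐ⊆R∪Id : ∀ {x y} → Pow R (suc m) x y → R x y ⊎ x ≡ y) where

    shorten-or-return : ∀ t {x w y} → Pow R (suc m) x w → Pow R t w y →
                        Pow R (suc t) x y ⊎ Star R y x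
    shorten-or-return t window rest with R¹⁺ᵐ⊆R∪Id window
    ... | inj₁ xRw = inj₁ (_ , xRw , rest)
    shorten-or-return zero    _                  (lift refl)        | inj₂ refl = inj₂ (0 , lift refl)
    shorten-or-return (suc t) (v , xRv , vRᵐx) (x′ , xRx′ , x′Rᵗy) | inj₂ refl =
      map (λ vRy → v , xRv , vRy) (λ y⇝v → Star-trans y⇝v (m , vRᵐx))
        (shorten-or-return t (Pow-snoc m vRᵐx xRx′) x′Rᵗy)

    R-or-return : ∀ n {x y} → Pow R (suc (m * n)) x y → R x y ⊎ Star R y x
    R-or-return zero    {x} {y} p = inj₁ (Pow-1⇒R (subst (λ k → Pow R (suc k) x y) (*-zeroʳ m) p))
    R-or-return (suc n) {x} {y} p =
      let _ , window , rest = Pow-split (suc m) (m * n) (subst (λ k → Pow R (suc k) x y) (*-suc m n) p)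
      in [ R-or-return n , inj₂ ] (shorten-or-return (m * n) window rest)

proposition7 : {a r : Level} (F : Frame a r) (m : ℕ) → m > 0 →
    (∀ x y → Pow (Frame.R F) (m + 1) x y → Frame.R F x y ⊎ x ≡ y) →
    ∀ (x y : Frame.X F) (n : ℕ) → Pow (Frame.R F) (m * n + 1) x y →
    ¬ SameCluster (Frame.R F) x y → Frame.R F x y
proposition7 F m _ H x y n p different =
  [ id , (λ y⇝x → ⊥-elim (different ((suc (m * n) , x⇝y) , y⇝x))) ] (R-or-return R m H′ n x⇝y)
  where
    open Frame F
    H′ : ∀ {u v} → Pow R (suc m) u v → R u v ⊎ u ≡ v
    H′ {u} {v} q = H u v (subst (λ k → Pow R k u v) (+-comm 1 m) q)
    x⇝y : Pow R (suc (m * n)) x y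
    x⇝y = subst (λ k → Pow R k x y) (+-comm (m * n) 1) p
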